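{- Let $F$ be a forest on $n$ vertices with $3\mid e(F)$ and $\alpha_s(F)\ge 2$, and let $\chi:E(K_n)\to\mathbb{Z}_3$ be a coloring with $\alpha_{C_4}(\chi)\ge 2$. Then $K_n$ contains a copy of $F$ whose edge colors sum to $0$ in $\mathbb{Z}_3$.
   Context: In a forest, the unique neighbor of a leaf is its parent. A quadruple of distinct vertices $(v_1,v_2,v_3,v_4)$ of a forest is a switching structure if either $v_1v_2v_3v_4$ is a path and $v_2,v_3$ both have degree exactly $2$, or $v_1$ and $v_4$ are the parents of leaves $v_2$ and $v_3$ respectively. $\alpha_s(F)$ is the maximum number of pairwise vertex-disjoint switching structures in $F$. For a coloring $\chi:E(K_N)\to\mathbb{Z}_3$, a $4$-cycle is alternating if the sums of the colors on its two perfect matchings are distinct; $\alpha_{C_4}(\chi)$ is the maximum number of pairwise vertex-disjoint alternating $4$-cycles. A copy of $F$ is a subgraph isomorphic to $F$. -}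

module Defs where

open import Data.Nat using (ℕ; zero; suc; _+_; _≤_; _%_)
open import Data.Fin using (Fin; _<_)
open import Data.Bool using (Bool; true; false; if_then_else_)
open import Data.List using (List; []; _∷_; _++_; [_]; length; map; allFin)
open import Data.Nat.ListAction using (sum)
open import Data.List.Relation.Unary.Unique.Propositional using (Unique)
open import Data.Product using (_×_; Σ; ∃; ∃-syntax; _,_)
open import Data.Sum using (_⊎_)
open import Relation.Binary.PropositionalEquality using (_≡_; _≢_)
open import Relation.Nullary using (¬_; Dec; yes; no)
open import Function.Definitions using (Injective)
open import Data.Fin using (_<?_)

Adj : ℕ → Set
Adj n = Fin n → Fin n → Bool

IsSimple : ∀ {n} → Adj n → Set
IsSimple {n} G = (∀ (u v : Fin n) → G u v ≡ G v u) × (∀ (u : Fin n) → G u u ≡ false)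

ConsecAdj : ∀ {n} → Adj n → List (Fin n) → Set
ConsecAdj G [] = Data.Unit.⊤ where import Data.Unit
ConsecAdj G (x ∷ []) = Data.Unit.⊤ where import Data.Unit
ConsecAdj G (x ∷ y ∷ r) = (G x y ≡ true) × ConsecAdj G (y ∷ r)

IsCycle : ∀ {n} → Adj n → List (Fin n) → Set
IsCycle G [] = Data.Empty.⊥ where import Data.Empty
IsCycle G (v ∷ vs) = (3 ≤ length (v ∷ vs)) × Unique (v ∷ vs) × ConsecAdj G (v ∷ vs ++ [ v ])

IsForest : ∀ {n} → Adj n → Set
IsForest {n} G = IsSimple G × (∀ (c : List (Fin n)) → ¬ IsCycle G c)

b2n : Bool → ℕ
b2n true = 1
b2n false = 0

degree : ∀ {n} → Adj n → Fin n → ℕ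
degree {n} G v = sum (map (λ u → b2n (G v u)) (allFin n))

edgeCount : ∀ {n} → Adj n → ℕ
edgeCount {n} G = sum (map (λ u → sum (map (λ v → lt u v) (allFin n))) (allFin n))
  where
  lt : Fin n → Fin n → ℕ
  lt u v with u <? v
  ... | yes _ = b2n (G u v)
  ... | no _ = 0

IsParentOfLeaf : ∀ {n} → Adj n → Fin n → Fin n → Set
IsParentOfLeaf G p ℓ = (degree G ℓ ≡ 1) × (G p ℓ ≡ true)

Distinct4 : ∀ {n} → Fin n → Fin n → Fin n → Fin n → Set
Distinct4 a b c d = Unique (a ∷ b ∷ c ∷ d ∷ [])

IsSwitching : ∀ {n} → Adj n → Fin n → Fin n → Fin n → Fin n → Set
IsSwitching G v₁ v₂ v₃ v₄ =
  Distinct4 v₁ v₂ v₃ v₄ ×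
  ( ( (G v₁ v₂ ≡ true) × (G v₂ v₃ ≡ true) × (G v₃ v₄ ≡ true)
      × (degree G v₂ ≡ 2) × (degree G v₃ ≡ 2) )
  ⊎ ( IsParentOfLeaf G v₁ v₂ × IsParentOfLeaf G v₄ v₃ ) )

AlphaS≥2 : ∀ {n} → Adj n → Set
AlphaS≥2 {n} G = Σ (Fin n) λ a₁ → Σ (Fin n) λ a₂ → Σ (Fin n) λ a₃ → Σ (Fin n) λ a₄ →
                 Σ (Fin n) λ b₁ → Σ (Fin n) λ b₂ → Σ (Fin n) λ b₃ → Σ (Fin n) λ b₄ →
  IsSwitching G a₁ a₂ a₃ a₄ × IsSwitching G b₁ b₂ b₃ b₄ ×
  Unique (a₁ ∷ a₂ ∷ a₃ ∷ a₄ ∷ b₁ ∷ b₂ ∷ b₃ ∷ b₄ ∷ [])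

-- a Z₃-colouring of E(K_n): symmetric function on pairs (diagonal irrelevant)
Colouring : ℕ → Set
Colouring n = Fin n → Fin n → Fin 3

IsSymColouring : ∀ {n} → Colouring n → Set
IsSymColouring {n} χ = ∀ (u v : Fin n) → χ u v ≡ χ v u

col : ∀ {n} → Colouring n → Fin n → Fin n → ℕ
col χ u v = Data.Fin.toℕ (χ u v) where import Data.Fin

IsAlternating : ∀ {n} → Colouring n → Fin n → Fin n → Fin n → Fin n → Set
IsAlternating χ a b c d =
  Distinct4 a b c d × ((col χ a b + col χ c d) % 3 ≢ (col χ b c + col χ d a) % 3)

AlphaC4≥2 : ∀ {n} → Colouring n → Set
AlphaC4≥2 {n} χ = Σ (Fin n) λ a₁ → Σ (Fin n) λ a₂ → Σ (Fin n) λ a₃ → Σ (Fin n) λ a₄ →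
                  Σ (Fin n) λ b₁ → Σ (Fin n) λ b₂ → Σ (Fin n) λ b₃ → Σ (Fin n) λ b₄ →
  IsAlternating χ a₁ a₂ a₃ a₄ × IsAlternating χ b₁ b₂ b₃ b₄ ×
  Unique (a₁ ∷ a₂ ∷ a₃ ∷ a₄ ∷ b₁ ∷ b₂ ∷ b₃ ∷ b₄ ∷ [])

imageColourSum : ∀ {n} → Adj n → Colouring n → (Fin n → Fin n) → ℕ
imageColourSum {n} G χ φ = sum (map (λ u → sum (map (λ v → term u v) (allFin n))) (allFin n))
  where
  term : Fin n → Fin n → ℕ
  term u v with u <? v
  ... | yes _ = if G u v then col χ (φ u) (φ v) else 0
  ... | no _ = 0

-- K_n contains a copy of G (on the same n vertices) with colour sum 0 in ℤ₃:
-- an injective map φ : V(G) → V(K_n) whose image edges have colours summing to 0 mod 3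
HasZeroSumCopy : ∀ {n} → Adj n → Colouring n → Set
HasZeroSumCopy {n} G χ = Σ (Fin n → Fin n) λ φ → Injective _≡_ _≡_ φ × (imageColourSum G χ φ % 3 ≡ 0)

-- Map the two switching structures of F onto the two alternating 4-cycles by an injection σ.
-- Exchanging the middle vertices x, y of a switching structure (p, x, y, q) changes the image of
-- F only by replacing the edges σp σx and σq σy with σp σy and σq σx: one perfect matching of the
-- 4-cycle σp σx σq σy is traded for the other, so the colour sum moves by a nonzero residue mod 3.
-- Performing neither, either or both exchanges yields colour sums s, s + δ₁, s + δ₂, s + δ₁ + δ₂
-- with δ₁, δ₂ ≢ 0 (mod 3), and one of these four is 0 (mod 3).

module Submission where

open import Defs
open import Data.Nat.Properties
  using ( +-identityʳ; +-comm; +-assoc; *-comm; *-cancelˡ-≡; *-distribˡ-+; +-monoʳ-≤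
        ; suc-injective; n≮n; allUpTo?; module ≤-Reasoning
        ; +-0-commutativeMonoid; +-commutativeSemigroup )
  renaming (_≟_ to _≟ℕ_)
open import Algebra.Properties.CommutativeMonoid.Sum +-0-commutativeMonoid
  using (sum-remove; sum-cong-≗; sum-replicate-zero; ∑-distrib-+; ∑-comm)
  renaming (sum to ∑)
open import Algebra.Properties.CommutativeSemigroup +-commutativeSemigroup using (xy∙z≈zy∙x)
open import Data.Bool using (true; false; if_then_else_)
open import Data.Fin using (Fin; zero; suc; toℕ; _<?_)
open import Data.Fin.Permutation.Components using (transpose; transpose-inverse)
open import Data.Fin.Properties using (_≟_; punchInᵢ≢i; <-asym; <-cmp)
open import Data.List using (List; []; _∷_; _++_; map; allFin; tabulate; length)
open import Data.List.Membership.Propositional using (_∈_; _∉_)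
open import Data.List.Membership.Propositional.Properties using (∈-++⁺ˡ; ∈-++⁺ʳ)
open import Data.List.Properties using (map-tabulate; map-cong)
open import Data.List.Relation.Binary.Disjoint.Propositional using (Disjoint)
open import Data.List.Relation.Binary.Pointwise using (Pointwise; []; _∷_)
open import Data.List.Relation.Unary.All as All using (All; []; _∷_)
open import Data.List.Relation.Unary.All.Properties using (¬Any⇒All¬)
open import Data.List.Relation.Unary.AllPairs using ([]; _∷_)
open import Data.List.Relation.Unary.Any using (here; there; any?)
open import Data.List.Relation.Unary.Unique.Propositional using (Unique)
open import Data.Nat using (ℕ; zero; suc; _+_; _*_; _%_; _≤_; _<_; z≤n)
open import Data.Nat.DivMod using ([m+kn]%n≡m%n; %-distribˡ-+; m%n%n≡m%n; m%n<n)
open import Data.Nat.ListAction using (sum)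
open import Data.Nat.Tactic.RingSolver using (solve-∀)
open import Data.Product using (Σ; _×_; _,_; proj₁; proj₂)
open import Data.Sum as Sum using (_⊎_; inj₁; inj₂)
open import Data.Vec.Functional using (removeAt; updateAt)
open import Data.Vec.Functional.Properties using (updateAt-updates; updateAt-minimal)
open import Function using (id; _∘_; const)
import Function.Construct.Composition as Comp
open import Function.Definitions using (Injective)
open import Relation.Binary.Definitions using (tri<; tri≈; tri>)
open import Relation.Binary.PropositionalEquality
open import Relation.Nullary using (Dec; yes; no; ¬?; contradiction)
open import Relation.Nullary.Decidable using (dec-true; dec-false; from-yes; _→-dec_; _⊎-dec_)

sum-tabulate : ∀ {n} (f : Fin n → ℕ) → sum (tabulate f) ≡ ∑ f
sum-tabulate {zero} f = refl
sum-tabulate {suc n} f = cong (f zero +_) (sum-tabulate (f ∘ suc))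

∑-agree-except : ∀ {n} {f g : Fin n → ℕ} (a : Fin n) → (∀ v → v ≢ a → f v ≡ g v) →
                 ∑ f + g a ≡ ∑ g + f a
∑-agree-except {suc n} {f} {g} a f≡g = begin
  ∑ f + g a                     ≡⟨ cong (_+ g a) (sum-remove f) ⟩
  f a + ∑ (removeAt f a) + g a  ≡⟨ cong (λ s → f a + s + g a) (sum-cong-≗ (λ k → f≡g _ (punchInᵢ≢i a k))) ⟩
  f a + ∑ (removeAt g a) + g a  ≡⟨ xy∙z≈zy∙x (f a) _ (g a) ⟩
  g a + ∑ (removeAt g a) + f a  ≡⟨ cong (_+ f a) (sum-remove g) ⟨
  ∑ g + f a                     ∎
  where open ≡-Reasoning

erase : ∀ {n} → (Fin n → ℕ) → Fin n → Fin n → ℕ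
erase f a = updateAt f a (const 0)

∑-pull : ∀ {n} (f : Fin n → ℕ) (a : Fin n) → ∑ f ≡ f a + ∑ (erase f a)
∑-pull f a = begin
  ∑ f                   ≡⟨ +-identityʳ _ ⟨
  ∑ f + 0               ≡⟨ cong (∑ f +_) (updateAt-updates a f) ⟨
  ∑ f + erase f a a     ≡⟨ ∑-agree-except a (λ v v≢a → sym (updateAt-minimal v a f v≢a)) ⟩
  ∑ (erase f a) + f a   ≡⟨ +-comm _ (f a) ⟩
  f a + ∑ (erase f a)   ∎
  where open ≡-Reasoning

sum-map-erase : ∀ {n} (f : Fin n → ℕ) {a : Fin n} {as} → All (a ≢_) as →
                sum (map (erase f a) as) ≡ sum (map f as)
sum-map-erase f []           = refl
sum-map-erase f (a≢b ∷ a≢bs) = cong₂ _+_ (updateAt-minimal _ _ f (a≢b ∘ sym)) (sum-map-erase f a≢bs)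

∑-supported : ∀ {n} {f : Fin n → ℕ} {as : List (Fin n)} → Unique as →
              (∀ v → v ∉ as → f v ≡ 0) → ∑ f ≡ sum (map f as)
∑-supported {n} {f} {[]} [] f≡0 = trans (sum-cong-≗ (λ v → f≡0 v λ ())) (sum-replicate-zero n)
∑-supported {n} {f} {a ∷ as} (a∉as ∷ as!) f≡0 = begin
  ∑ f                            ≡⟨ ∑-pull f a ⟩
  f a + ∑ (erase f a)            ≡⟨ cong (f a +_) (∑-supported as! erased≡0) ⟩
  f a + sum (map (erase f a) as) ≡⟨ cong (f a +_) (sum-map-erase f a∉as) ⟩
  f a + sum (map f as)           ∎
  where
  open ≡-Reasoning
  erased≡0 : ∀ v → v ∉ as → erase f a v ≡ 0
  erased≡0 v v∉as with v ≟ a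
  ... | yes refl = updateAt-updates a f
  ... | no v≢a   = trans (updateAt-minimal v a f v≢a) (f≡0 v λ { (here v≡a) → v≢a v≡a ; (there v∈as) → v∉as v∈as })

sum-map-≤-∑ : ∀ {n} (f : Fin n → ℕ) {as : List (Fin n)} → Unique as → sum (map f as) ≤ ∑ f
sum-map-≤-∑ f {[]}     []            = z≤n
sum-map-≤-∑ f {a ∷ as} (a∉as ∷ as!) = begin
  f a + sum (map f as)            ≡⟨ cong (f a +_) (sum-map-erase f a∉as) ⟨
  f a + sum (map (erase f a) as)  ≤⟨ +-monoʳ-≤ (f a) (sum-map-≤-∑ _ as!) ⟩
  f a + ∑ (erase f a)             ≡⟨ ∑-pull f a ⟨
  ∑ f                             ∎
  where open ≤-Reasoning

sum-allFin : ∀ {n} (f : Fin n → ℕ) → sum (map f (allFin n)) ≡ ∑ f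
sum-allFin f = trans (cong sum (map-tabulate id f)) (sum-tabulate f)

-- (b − a) mod 3, written without truncated subtraction.
_⊖₃_ : ℕ → ℕ → ℕ
b ⊖₃ a = (b + 2 * a) % 3

⊖₃-shift : ∀ {x y a b} → x + a ≡ y + b → x % 3 ≡ (y % 3 + b ⊖₃ a) % 3
⊖₃-shift {x} {y} {a} {b} eq = begin
  x % 3                        ≡⟨ [m+kn]%n≡m%n x a 3 ⟨
  (x + a * 3) % 3              ≡⟨ cong (λ m → (x + m) % 3) (*-comm a 3) ⟩
  (x + (a + 2 * a)) % 3        ≡⟨ cong (_% 3) (+-assoc x a _) ⟨
  (x + a + 2 * a) % 3          ≡⟨ cong (λ m → (m + 2 * a) % 3) eq ⟩
  (y + b + 2 * a) % 3          ≡⟨ cong (_% 3) (+-assoc y b _) ⟩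
  (y + (b + 2 * a)) % 3        ≡⟨ %-distribˡ-+ y _ 3 ⟩
  (y % 3 + b ⊖₃ a) % 3         ∎
  where open ≡-Reasoning

⊖₃-nonzero : ∀ {a b} → a % 3 ≢ b % 3 → b ⊖₃ a ≢ 0
⊖₃-nonzero {a} {b} a≢b b⊖a≡0 = a≢b (sym (begin
  b % 3                        ≡⟨ [m+kn]%n≡m%n b a 3 ⟨
  (b + a * 3) % 3              ≡⟨ cong (λ m → (b + m) % 3) (trans (*-comm a 3) (+-comm a _)) ⟩
  (b + (2 * a + a)) % 3        ≡⟨ cong (_% 3) (+-assoc b _ a) ⟨
  (b + 2 * a + a) % 3          ≡⟨ %-distribˡ-+ (b + 2 * a) a 3 ⟩
  (b ⊖₃ a + a % 3) % 3         ≡⟨ cong (λ r → (r + a % 3) % 3) b⊖a≡0 ⟩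
  a % 3 % 3                    ≡⟨ m%n%n≡m%n a 3 ⟩
  a % 3                        ∎))
  where open ≡-Reasoning

ZeroAmongShifts : ℕ → ℕ → ℕ → Set
ZeroAmongShifts r d e =
  d ≢ 0 → e ≢ 0 →
  r ≡ 0 ⊎ (r + d) % 3 ≡ 0 ⊎ (r + e) % 3 ≡ 0 ⊎ ((r + e) % 3 + d) % 3 ≡ 0

zeroAmongShifts? : ∀ r d e → Dec (ZeroAmongShifts r d e)
zeroAmongShifts? r d e =
  ¬? (d ≟ℕ 0) →-dec ¬? (e ≟ℕ 0) →-dec
  (r ≟ℕ 0 ⊎-dec (r + d) % 3 ≟ℕ 0 ⊎-dec (r + e) % 3 ≟ℕ 0 ⊎-dec ((r + e) % 3 + d) % 3 ≟ℕ 0)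

zero-among-shifts : ∀ {r} → r < 3 → ∀ {d} → d < 3 → ∀ {e} → e < 3 → ZeroAmongShifts r d e
zero-among-shifts = from-yes (allUpTo? (λ r → allUpTo? (λ d → allUpTo? (zeroAmongShifts? r d) 3) 3) 3)

zero-residue-among-swaps : ∀ {s₀₀ s₁₀ s₀₁ s₁₁ a₁ b₁ a₂ b₂} →
  s₁₀ + a₁ ≡ s₀₀ + b₁ → s₀₁ + a₂ ≡ s₀₀ + b₂ → s₁₁ + a₁ ≡ s₀₁ + b₁ →
  a₁ % 3 ≢ b₁ % 3 → a₂ % 3 ≢ b₂ % 3 →
  s₀₀ % 3 ≡ 0 ⊎ s₁₀ % 3 ≡ 0 ⊎ s₀₁ % 3 ≡ 0 ⊎ s₁₁ % 3 ≡ 0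
zero-residue-among-swaps {s₀₀} {s₁₀} {s₀₁} {s₁₁} {a₁} {b₁} {a₂} {b₂} e₁₀ e₀₁ e₁₁ a₁≢b₁ a₂≢b₂ =
  Sum.map₂ (Sum.map (trans s₁₀-shift) (Sum.map (trans s₀₁-shift) (trans s₁₁-shift)))
    (zero-among-shifts (m%n<n s₀₀ 3) (m%n<n (b₁ + 2 * a₁) 3) (m%n<n (b₂ + 2 * a₂) 3)
      (⊖₃-nonzero {a₁} {b₁} a₁≢b₁) (⊖₃-nonzero {a₂} {b₂} a₂≢b₂))
  where
  s₁₀-shift : s₁₀ % 3 ≡ (s₀₀ % 3 + b₁ ⊖₃ a₁) % 3
  s₁₀-shift = ⊖₃-shift {s₁₀} {s₀₀} {a₁} {b₁} e₁₀
  s₀₁-shift : s₀₁ % 3 ≡ (s₀₀ % 3 + b₂ ⊖₃ a₂) % 3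
  s₀₁-shift = ⊖₃-shift {s₀₁} {s₀₀} {a₂} {b₂} e₀₁
  s₁₁-shift : s₁₁ % 3 ≡ ((s₀₀ % 3 + b₂ ⊖₃ a₂) % 3 + b₁ ⊖₃ a₁) % 3
  s₁₁-shift = trans (⊖₃-shift {s₁₁} {s₀₁} {a₁} {b₁} e₁₁) (cong (λ r → (r + b₁ ⊖₃ a₁) % 3) s₀₁-shift)

module _ {n} (i j : Fin n) where

  transpose-matchˡ : transpose i j i ≡ j
  transpose-matchˡ rewrite dec-true (i ≟ i) refl = refl

  transpose-matchʳ : transpose i j j ≡ i
  transpose-matchʳ with j ≟ i
  ... | yes j≡i = j≡i
  ... | no _ rewrite dec-true (j ≟ j) refl = refl

  transpose-other : ∀ {k} → k ≢ i → k ≢ j → transpose i j k ≡ k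
  transpose-other {k} k≢i k≢j rewrite dec-false (k ≟ i) k≢i | dec-false (k ≟ j) k≢j = refl

  transpose-injective : Injective _≡_ _≡_ (transpose i j)
  transpose-injective {k} {l} eq = begin
    k                               ≡⟨ transpose-inverse j i ⟨
    transpose j i (transpose i j k) ≡⟨ cong (transpose j i) eq ⟩
    transpose j i (transpose i j l) ≡⟨ transpose-inverse j i ⟩
    l                               ∎
    where open ≡-Reasoning

∘-transpose-injective : ∀ {n} {φ : Fin n → Fin n} → Injective _≡_ _≡_ φ →
                        ∀ i j → Injective _≡_ _≡_ (φ ∘ transpose i j)
∘-transpose-injective φ-inj i j = Comp.injective _≡_ _≡_ _≡_ (transpose-injective i j) φ-inj

extend-injection : ∀ {n} (xs ys : List (Fin n)) → Unique xs → Unique ys → length xs ≡ length ys →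
                   Σ (Fin n → Fin n) λ σ → Injective _≡_ _≡_ σ × Pointwise (λ x y → σ x ≡ y) xs ys
extend-injection []       []       _            _            _   = id , id , []
extend-injection (x ∷ xs) (y ∷ ys) (x∉xs ∷ xs!) (y∉ys ∷ ys!) len
  with extend-injection xs ys xs! ys! (suc-injective len)
... | σ , σ-inj , σxs≡ys =
  transpose (σ x) y ∘ σ , Comp.injective _≡_ _≡_ _≡_ σ-inj (transpose-injective (σ x) y) ,
  transpose-matchˡ (σ x) y ∷ fixed σxs≡ys x∉xs y∉ys
  where
  fixed : ∀ {zs ws} → Pointwise (λ z w → σ z ≡ w) zs ws → All (x ≢_) zs → All (y ≢_) ws →
          Pointwise (λ z w → transpose (σ x) y (σ z) ≡ w) zs ws
  fixed []                []           []           = []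
  fixed (refl ∷ σzs≡ws) (x≢z ∷ x≢zs) (y≢w ∷ y≢ws) =
    transpose-other (σ x) y (λ σz≡σx → x≢z (σ-inj (sym σz≡σx))) (y≢w ∘ sym) ∷ fixed σzs≡ws x≢zs y≢ws

Unique-++⇒Disjoint : ∀ {A : Set} {xs ys : List A} → Unique (xs ++ ys) → Disjoint xs ys
Unique-++⇒Disjoint {xs = x ∷ xs} (x∉ ∷ _)      (here refl  , v∈ys) = All.lookup x∉ (∈-++⁺ʳ xs v∈ys) refl
Unique-++⇒Disjoint {xs = x ∷ xs} (_ ∷ xs++ys!) (there v∈xs , v∈ys) = Unique-++⇒Disjoint xs++ys! (v∈xs , v∈ys)

module _ {A : Set} where

  open import Data.List.Relation.Binary.Permutation.Setoid (setoid A) using (↭-refl; ↭-swap)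
  open import Data.List.Relation.Binary.Permutation.Setoid.Properties (setoid A) using (Unique-resp-↭; ++⁺ˡ)

  Unique-swap : ∀ xs (a b : A) {ys} → Unique (xs ++ a ∷ b ∷ ys) → Unique (xs ++ b ∷ a ∷ ys)
  Unique-swap xs a b = Unique-resp-↭ (++⁺ˡ xs (↭-swap a b ↭-refl))

module _ {n} {G : Adj n} {v : Fin n} where

  count-neighbours : ∀ {as} → All (λ u → G v u ≡ true) as → sum (map (λ u → b2n (G v u)) as) ≡ length as
  count-neighbours []                 = refl
  count-neighbours (v—a ∷ v—as) rewrite v—a = cong suc (count-neighbours v—as)

  neighbours-≤-degree : ∀ {as} → Unique as → All (λ u → G v u ≡ true) as → length as ≤ degree G v
  neighbours-≤-degree {as} as! v—as = begin
    length as                          ≡⟨ count-neighbours v—as ⟨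
    sum (map (λ u → b2n (G v u)) as)   ≤⟨ sum-map-≤-∑ (λ u → b2n (G v u)) as! ⟩
    ∑ (λ u → b2n (G v u))              ≡⟨ sum-allFin (λ u → b2n (G v u)) ⟨
    degree G v                         ∎
    where open ≤-Reasoning

  degree≡length⇒neighbour-∈ : ∀ {as u} → Unique as → All (λ w → G v w ≡ true) as →
                              degree G v ≡ length as → G v u ≡ true → u ∈ as
  degree≡length⇒neighbour-∈ {as} {u} as! v—as deg≡ v—u with any? (u ≟_) as
  ... | yes u∈as = u∈as
  ... | no  u∉as = contradiction (subst (suc (length as) ≤_) deg≡ more) (n≮n (length as))
    where
    more : suc (length as) ≤ degree G v
    more = neighbours-≤-degree (¬Any⇒All¬ as u∉as ∷ as!) (v—u ∷ v—as)

record Swappable {n} (G : Adj n) (p x y q : Fin n) : Set where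
  constructor swappable
  field
    p≢x : p ≢ x
    p≢y : p ≢ y
    p≢q : p ≢ q
    x≢y : x ≢ y
    x≢q : x ≢ q
    y≢q : y ≢ q
    p—x : G p x ≡ true
    q—y : G q y ≡ true
    x-neighbours : ∀ {v} → G x v ≡ true → v ∈ p ∷ y ∷ []
    y-neighbours : ∀ {v} → G y v ≡ true → v ∈ q ∷ x ∷ []

switching⇒swappable : ∀ {n} {G : Adj n} {p x y q} → IsSimple G → IsSwitching G p x y q → Swappable G p x y q
switching⇒swappable {G = G} {p} {x} {y} {q} (G-sym , _)
  (((p≢x ∷ p≢y ∷ p≢q ∷ []) ∷ (x≢y ∷ x≢q ∷ []) ∷ (y≢q ∷ []) ∷ [] ∷ []) , shape) with shape
... | inj₁ (p—x , x—y , y—q , deg-x , deg-y) =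
  swappable p≢x p≢y p≢q x≢y x≢q y≢q p—x (trans (G-sym q y) y—q)
    (degree≡length⇒neighbour-∈ {G = G} {x} ((p≢y ∷ []) ∷ [] ∷ []) (trans (G-sym x p) p—x ∷ x—y ∷ []) deg-x)
    (degree≡length⇒neighbour-∈ {G = G} {y} ((x≢q ∘ sym ∷ []) ∷ [] ∷ []) (y—q ∷ trans (G-sym y x) x—y ∷ []) deg-y)
... | inj₂ ((deg-x , p—x) , (deg-y , q—y)) =
  swappable p≢x p≢y p≢q x≢y x≢q y≢q p—x q—y
    (∈-++⁺ˡ ∘ degree≡length⇒neighbour-∈ {G = G} {x} ([] ∷ []) (trans (G-sym x p) p—x ∷ []) deg-x)
    (∈-++⁺ˡ ∘ degree≡length⇒neighbour-∈ {G = G} {y} ([] ∷ []) (trans (G-sym y q) q—y ∷ []) deg-y)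

matching₁ matching₂ : ∀ {n} → Colouring n → Fin n → Fin n → Fin n → Fin n → ℕ
matching₁ χ a b c d = col χ a b + col χ c d
matching₂ χ a b c d = col χ b c + col χ d a

Alternates : ∀ {n} → Colouring n → Fin n → Fin n → Fin n → Fin n → Set
Alternates χ a b c d = matching₁ χ a b c d % 3 ≢ matching₂ χ a b c d % 3

module _ {n} (G : Adj n) (χ : Colouring n) where

  edgeColour : (Fin n → Fin n) → Fin n → Fin n → ℕ
  edgeColour φ u v = if G u v then col χ (φ u) (φ v) else 0

  upperEdgeColour : (Fin n → Fin n) → Fin n → Fin n → ℕ
  upperEdgeColour φ u v with u <? v
  ... | yes _ = edgeColour φ u v
  ... | no  _ = 0

  -- Summing over ordered pairs avoids the order u < v, which swapping x and y does not respect.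
  orderedColourSum : (Fin n → Fin n) → ℕ
  orderedColourSum φ = ∑ λ u → ∑ λ v → edgeColour φ u v

  -- The summand of imageColourSum is local to its definition in Defs and cannot be named,
  -- so the left-hand side in the type of summand≡upperEdgeColour is left to unification.
  mutual
    imageColourSum≡∑∑ : ∀ φ → imageColourSum G χ φ ≡ ∑ λ u → ∑ λ v → upperEdgeColour φ u v
    imageColourSum≡∑∑ φ =
      trans (cong sum (map-cong (λ u → trans (cong sum (map-cong (summand≡upperEdgeColour φ u) (allFin n)))
                                             (sum-allFin (upperEdgeColour φ u)))
                                (allFin n)))
            (sum-allFin (∑ ∘ upperEdgeColour φ))

    summand≡upperEdgeColour : ∀ φ u v → _ ≡ upperEdgeColour φ u v
    summand≡upperEdgeColour φ u v with u <? v
    ... | yes _ = refl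
    ... | no  _ = refl

  edgeColour-edge : ∀ φ {u v} → G u v ≡ true → edgeColour φ u v ≡ col χ (φ u) (φ v)
  edgeColour-edge φ u—v rewrite u—v = refl

  module _ (simple : IsSimple G) (χ-sym : IsSymColouring χ) where

    private
      G-sym : ∀ u v → G u v ≡ G v u
      G-sym = proj₁ simple
      G-loopless : ∀ u → G u u ≡ false
      G-loopless = proj₂ simple

    col-sym : ∀ a b → col χ a b ≡ col χ b a
    col-sym a b = cong toℕ (χ-sym a b)

    edgeColour-sym : ∀ φ u v → edgeColour φ u v ≡ edgeColour φ v u
    edgeColour-sym φ u v rewrite G-sym u v with G v u
    ... | true  = col-sym (φ u) (φ v)
    ... | false = refl

    edgeColour-loop : ∀ φ u → edgeColour φ u u ≡ 0
    edgeColour-loop φ u rewrite G-loopless u = refl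

    edgeColour-split : ∀ φ u v → edgeColour φ u v ≡ upperEdgeColour φ u v + upperEdgeColour φ v u
    edgeColour-split φ u v with u <? v | v <? u
    ... | yes u<v | yes v<u = contradiction v<u (<-asym u<v)
    ... | yes _   | no  _   = sym (+-identityʳ _)
    ... | no  _   | yes _   = edgeColour-sym φ u v
    ... | no  u≮v | no  v≮u with <-cmp u v
    ...   | tri< u<v _ _  = contradiction u<v u≮v
    ...   | tri≈ _ refl _ = edgeColour-loop φ u
    ...   | tri> _ _ v<u  = contradiction v<u v≮u

    orderedColourSum≡2*imageColourSum : ∀ φ → orderedColourSum φ ≡ 2 * imageColourSum G χ φ
    orderedColourSum≡2*imageColourSum φ = begin
      (∑ λ u → ∑ λ v → edgeColour φ u v)
        ≡⟨ sum-cong-≗ (λ u → sum-cong-≗ (edgeColour-split φ u)) ⟩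
      (∑ λ u → ∑ λ v → upper u v + upper v u)
        ≡⟨ sum-cong-≗ (λ u → ∑-distrib-+ (upper u) (λ v → upper v u)) ⟩
      (∑ λ u → ∑ (upper u) + ∑ λ v → upper v u)
        ≡⟨ ∑-distrib-+ (∑ ∘ upper) (λ u → ∑ λ v → upper v u) ⟩
      U + (∑ λ u → ∑ λ v → upper v u)
        ≡⟨ cong (U +_) (∑-comm (λ u v → upper v u)) ⟩
      U + U
        ≡⟨ cong (λ s → s + s) (imageColourSum≡∑∑ φ) ⟨
      I + I
        ≡⟨ cong (I +_) (+-identityʳ I) ⟨
      2 * I
        ∎
      where
      open ≡-Reasoning
      upper : Fin n → Fin n → ℕ
      upper = upperEdgeColour φ
      U I : ℕ
      U = ∑ λ u → ∑ (upper u)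
      I = imageColourSum G χ φ

    module _ {p x y q : Fin n} (S : Swappable G p x y q) where

      open Swappable S

      -- Swapping x and y changes the colour of an ordered edge (u , v) only if v = partner u.
      partner : Fin n → Fin n
      partner = transpose p x ∘ transpose q y

      partner-p : partner p ≡ x
      partner-p = trans (cong (transpose p x) (transpose-other q y p≢q p≢y)) (transpose-matchˡ p x)

      partner-x : partner x ≡ p
      partner-x = trans (cong (transpose p x) (transpose-other q y x≢q x≢y)) (transpose-matchʳ p x)

      partner-q : partner q ≡ y
      partner-q = trans (cong (transpose p x) (transpose-matchˡ q y)) (transpose-other p x (p≢y ∘ sym) (x≢y ∘ sym))

      partner-y : partner y ≡ q
      partner-y = trans (cong (transpose p x) (transpose-matchʳ q y)) (transpose-other p x (p≢q ∘ sym) (x≢q ∘ sym))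

      partner-other : ∀ {u} → u ∉ p ∷ x ∷ q ∷ y ∷ [] → partner u ≡ u
      partner-other u∉ =
        trans (cong (transpose p x) (transpose-other q y (u∉ ∘ there ∘ there ∘ here) (u∉ ∘ there ∘ there ∘ there ∘ here)))
              (transpose-other p x (u∉ ∘ here) (u∉ ∘ there ∘ here))

      private
        colour∘τ : (Fin n → Fin n) → Fin n → Fin n → ℕ
        colour∘τ φ u v = col χ (φ (transpose x y u)) (φ (transpose x y v))

      swapped-colour-at-x : ∀ (φ : Fin n → Fin n) {v} → G x v ≡ true → v ≢ partner x →
                            colour∘τ φ x v ≡ col χ (φ x) (φ v)
      swapped-colour-at-x φ x—v v≢πx with x-neighbours x—v
      ... | here refl         = contradiction (sym partner-x) v≢πx
      ... | there (here refl) =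
        trans (cong₂ (λ a b → col χ (φ a) (φ b)) (transpose-matchˡ x y) (transpose-matchʳ x y)) (col-sym (φ y) (φ x))

      swapped-colour-at-y : ∀ (φ : Fin n → Fin n) {v} → G y v ≡ true → v ≢ partner y →
                            colour∘τ φ y v ≡ col χ (φ y) (φ v)
      swapped-colour-at-y φ y—v v≢πy with y-neighbours y—v
      ... | here refl         = contradiction (sym partner-y) v≢πy
      ... | there (here refl) =
        trans (cong₂ (λ a b → col χ (φ a) (φ b)) (transpose-matchʳ x y) (transpose-matchˡ x y)) (col-sym (φ x) (φ y))

      swapped-colour-elsewhere : ∀ (φ : Fin n → Fin n) {u v} → G u v ≡ true → v ≢ partner u → u ≢ x → u ≢ y →
                                 colour∘τ φ u v ≡ col χ (φ u) (φ v)
      swapped-colour-elsewhere φ {u} {v} u—v v≢πu u≢x u≢y =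
        cong₂ (λ a b → col χ (φ a) (φ b)) (transpose-other x y u≢x u≢y) (transpose-other x y v≢x v≢y)
        where
        v≢x : v ≢ x
        v≢x refl with x-neighbours (trans (G-sym x u) u—v)
        ... | here refl         = v≢πu (sym partner-p)
        ... | there (here refl) = u≢y refl
        v≢y : v ≢ y
        v≢y refl with y-neighbours (trans (G-sym y u) u—v)
        ... | here refl         = v≢πu (sym partner-q)
        ... | there (here refl) = u≢x refl

      swapped-colour : ∀ (φ : Fin n → Fin n) {u v} → G u v ≡ true → v ≢ partner u → colour∘τ φ u v ≡ col χ (φ u) (φ v)
      swapped-colour φ {u} u—v v≢πu with x ≟ u | y ≟ u
      ... | yes refl | _        = swapped-colour-at-x φ u—v v≢πu
      ... | no _     | yes refl = swapped-colour-at-y φ u—v v≢πu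
      ... | no x≢u   | no y≢u   = swapped-colour-elsewhere φ u—v v≢πu (x≢u ∘ sym) (y≢u ∘ sym)

      swap-agrees : ∀ (φ : Fin n → Fin n) u v → v ≢ partner u → edgeColour (φ ∘ transpose x y) u v ≡ edgeColour φ u v
      swap-agrees φ u v v≢πu with G u v in u—v
      ... | true  = swapped-colour φ u—v v≢πu
      ... | false = refl

      orderedColourSum-swap : ∀ (φ : Fin n → Fin n) →
        orderedColourSum (φ ∘ transpose x y) + ∑ (λ u → edgeColour φ u (partner u)) ≡
        orderedColourSum φ + ∑ (λ u → edgeColour (φ ∘ transpose x y) u (partner u))
      orderedColourSum-swap φ = begin
        ∑ row∘τ + ∑ across            ≡⟨ ∑-distrib-+ row∘τ across ⟨
        ∑ (λ u → row∘τ u + across u)  ≡⟨ sum-cong-≗ (λ u → ∑-agree-except (partner u) (swap-agrees φ u)) ⟩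
        ∑ (λ u → row u + across∘τ u)  ≡⟨ ∑-distrib-+ row across∘τ ⟩
        ∑ row + ∑ across∘τ            ∎
        where
        open ≡-Reasoning
        row row∘τ across across∘τ : Fin n → ℕ
        row u = ∑ (edgeColour φ u)
        row∘τ u = ∑ (edgeColour (φ ∘ transpose x y) u)
        across u = edgeColour φ u (partner u)
        across∘τ u = edgeColour (φ ∘ transpose x y) u (partner u)

      ∑-across-partner : ∀ (φ : Fin n → Fin n) →
        ∑ (λ u → edgeColour φ u (partner u)) ≡ 2 * matching₁ χ (φ p) (φ x) (φ q) (φ y)
      ∑-across-partner φ = begin
        ∑ across
          ≡⟨ ∑-supported distinct across-other ⟩
        sum (map across (p ∷ x ∷ q ∷ y ∷ []))
          ≡⟨ cong₂ _+_ (across-edge partner-p p—x) (cong₂ _+_ (across-edge partner-x x—p)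
               (cong₂ _+_ (across-edge partner-q q—y) (cong (_+ 0) (across-edge partner-y y—q)))) ⟩
        c p x + (c x p + (c q y + (c y q + 0)))
          ≡⟨ cong₂ (λ a b → c p x + (a + (c q y + (b + 0)))) (col-sym (φ x) (φ p)) (col-sym (φ y) (φ q)) ⟩
        c p x + (c p x + (c q y + (c q y + 0)))
          ≡⟨ twice (c p x) (c q y) ⟩
        2 * (c p x + c q y)
          ∎
        where
        open ≡-Reasoning
        across : Fin n → ℕ
        across u = edgeColour φ u (partner u)
        c : Fin n → Fin n → ℕ
        c u v = col χ (φ u) (φ v)
        x—p : G x p ≡ true
        x—p = trans (G-sym x p) p—x
        y—q : G y q ≡ true
        y—q = trans (G-sym y q) q—y
        distinct : Unique (p ∷ x ∷ q ∷ y ∷ [])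
        distinct = (p≢x ∷ p≢q ∷ p≢y ∷ []) ∷ (x≢q ∷ x≢y ∷ []) ∷ (y≢q ∘ sym ∷ []) ∷ [] ∷ []
        across-other : ∀ u → u ∉ p ∷ x ∷ q ∷ y ∷ [] → across u ≡ 0
        across-other u u∉ = trans (cong (edgeColour φ u) (partner-other u∉)) (edgeColour-loop φ u)
        across-edge : ∀ {u v} → partner u ≡ v → G u v ≡ true → across u ≡ c u v
        across-edge refl = edgeColour-edge φ
        twice : ∀ a b → a + (a + (b + (b + 0))) ≡ 2 * (a + b)
        twice = solve-∀

      imageColourSum-swap : ∀ (φ : Fin n → Fin n) →
        imageColourSum G χ (φ ∘ transpose x y) + matching₁ χ (φ p) (φ x) (φ q) (φ y) ≡
        imageColourSum G χ φ + matching₂ χ (φ p) (φ x) (φ q) (φ y)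
      imageColourSum-swap φ = *-cancelˡ-≡ _ _ 2 (begin
        2 * (I∘τ + m₁)
          ≡⟨ *-distribˡ-+ 2 I∘τ m₁ ⟩
        2 * I∘τ + 2 * m₁
          ≡⟨ cong₂ _+_ (orderedColourSum≡2*imageColourSum ψ) (∑-across-partner φ) ⟨
        orderedColourSum ψ + ∑ (λ u → edgeColour φ u (partner u))
          ≡⟨ orderedColourSum-swap φ ⟩
        orderedColourSum φ + ∑ (λ u → edgeColour ψ u (partner u))
          ≡⟨ cong₂ _+_ (orderedColourSum≡2*imageColourSum φ) (trans (∑-across-partner ψ) (cong (2 *_) swapped-matching)) ⟩
        2 * I + 2 * m₂
          ≡⟨ *-distribˡ-+ 2 I m₂ ⟨
        2 * (I + m₂)
          ∎)
        where
        open ≡-Reasoning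
        ψ : Fin n → Fin n
        ψ = φ ∘ transpose x y
        I I∘τ m₁ m₂ : ℕ
        I = imageColourSum G χ φ
        I∘τ = imageColourSum G χ ψ
        m₁ = matching₁ χ (φ p) (φ x) (φ q) (φ y)
        m₂ = matching₂ χ (φ p) (φ x) (φ q) (φ y)
        swapped-matching : matching₁ χ (ψ p) (ψ x) (ψ q) (ψ y) ≡ m₂
        swapped-matching
          rewrite transpose-other x y p≢x p≢y | transpose-matchˡ x y
                | transpose-other x y (x≢q ∘ sym) (y≢q ∘ sym) | transpose-matchʳ x y
          = trans (+-comm (col χ (φ p) (φ y)) _) (cong₂ _+_ (col-sym (φ q) (φ x)) (col-sym (φ p) (φ y)))

disjoint-swaps⇒zeroSumCopy : ∀ {n} {G : Adj n} {χ : Colouring n} {p x y q p′ x′ y′ q′} →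
  IsSimple G → IsSymColouring χ → Swappable G p x y q → Swappable G p′ x′ y′ q′ →
  Disjoint (p ∷ x ∷ y ∷ q ∷ []) (p′ ∷ x′ ∷ y′ ∷ q′ ∷ []) →
  (σ : Fin n → Fin n) → Injective _≡_ _≡_ σ →
  Alternates χ (σ p) (σ x) (σ q) (σ y) → Alternates χ (σ p′) (σ x′) (σ q′) (σ y′) →
  HasZeroSumCopy G χ
disjoint-swaps⇒zeroSumCopy {n} {G} {χ} {p} {x} {y} {q} {p′} {x′} {y′} {q′} simple χ-sym S S′ disjoint σ σ-inj alt alt′ =
  choose (zero-residue-among-swaps {I σ} {I (σ ∘ τ)} {I (σ ∘ τ′)} {I (σ ∘ τ′ ∘ τ)} {m₁} {m₂} {m₁′} {m₂′}
           (imageColourSum-swap G χ simple χ-sym S σ) (imageColourSum-swap G χ simple χ-sym S′ σ)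
           swap-after-swap′ alt alt′)
  where
  I : (Fin n → Fin n) → ℕ
  I = imageColourSum G χ
  τ τ′ : Fin n → Fin n
  τ  = transpose x y
  τ′ = transpose x′ y′
  m₁ m₂ m₁′ m₂′ : ℕ
  m₁ = matching₁ χ (σ p) (σ x) (σ q) (σ y)
  m₂ = matching₂ χ (σ p) (σ x) (σ q) (σ y)
  m₁′ = matching₁ χ (σ p′) (σ x′) (σ q′) (σ y′)
  m₂′ = matching₂ χ (σ p′) (σ x′) (σ q′) (σ y′)

  τ′-fixes : ∀ {v} → v ∈ p ∷ x ∷ y ∷ q ∷ [] → τ′ v ≡ v
  τ′-fixes v∈ = transpose-other x′ y′ (λ { refl → disjoint (v∈ , there (here refl)) })
                                      (λ { refl → disjoint (v∈ , there (there (here refl))) })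

  images-fixed : (f : Fin n → Fin n → Fin n → Fin n → ℕ) →
                 f (σ (τ′ p)) (σ (τ′ x)) (σ (τ′ q)) (σ (τ′ y)) ≡ f (σ p) (σ x) (σ q) (σ y)
  images-fixed f rewrite τ′-fixes (here refl) | τ′-fixes (there (here refl))
                       | τ′-fixes (there (there (here refl))) | τ′-fixes (there (there (there (here refl)))) = refl

  swap-after-swap′ : I (σ ∘ τ′ ∘ τ) + m₁ ≡ I (σ ∘ τ′) + m₂
  swap-after-swap′ = subst₂ (λ a b → I (σ ∘ τ′ ∘ τ) + a ≡ I (σ ∘ τ′) + b)
                            (images-fixed (matching₁ χ)) (images-fixed (matching₂ χ))
                            (imageColourSum-swap G χ simple χ-sym S (σ ∘ τ′))

  choose : I σ % 3 ≡ 0 ⊎ I (σ ∘ τ) % 3 ≡ 0 ⊎ I (σ ∘ τ′) % 3 ≡ 0 ⊎ I (σ ∘ τ′ ∘ τ) % 3 ≡ 0 →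
           HasZeroSumCopy G χ
  choose (inj₁ zero-sum)               = σ , σ-inj , zero-sum
  choose (inj₂ (inj₁ zero-sum))        = σ ∘ τ , ∘-transpose-injective σ-inj x y , zero-sum
  choose (inj₂ (inj₂ (inj₁ zero-sum))) = σ ∘ τ′ , ∘-transpose-injective σ-inj x′ y′ , zero-sum
  choose (inj₂ (inj₂ (inj₂ zero-sum))) =
    σ ∘ τ′ ∘ τ , ∘-transpose-injective (∘-transpose-injective σ-inj x′ y′) x y , zero-sum

proposition4p4 : (n : ℕ) (F : Adj n) (χ : Colouring n) →
    IsForest F → edgeCount F % 3 ≡ 0 → AlphaS≥2 F →
    IsSymColouring χ → AlphaC4≥2 χ →
    HasZeroSumCopy F χ
proposition4p4 n F χ (simple , _) _ (v₁ , v₂ , v₃ , v₄ , w₁ , w₂ , w₃ , w₄ , switching-v , switching-w , vw!)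
  χ-sym (c₁ , c₂ , c₃ , c₄ , d₁ , d₂ , d₃ , d₄ , (_ , alternating-c) , (_ , alternating-d) , cd!)
  -- σ maps (v₁, v₂, v₄, v₃) onto the 4-cycle (c₁, c₂, c₃, c₄), and likewise for the w's and d's.
  with extend-injection (v₁ ∷ v₂ ∷ v₃ ∷ v₄ ∷ w₁ ∷ w₂ ∷ w₃ ∷ w₄ ∷ [])
                        (c₁ ∷ c₂ ∷ c₄ ∷ c₃ ∷ d₁ ∷ d₂ ∷ d₄ ∷ d₃ ∷ [])
                        vw! (Unique-swap (c₁ ∷ c₂ ∷ c₄ ∷ c₃ ∷ d₁ ∷ d₂ ∷ []) d₃ d₄
                              (Unique-swap (c₁ ∷ c₂ ∷ []) c₃ c₄ cd!)) refl
... | σ , σ-inj , (refl ∷ refl ∷ refl ∷ refl ∷ refl ∷ refl ∷ refl ∷ refl ∷ []) =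
  disjoint-swaps⇒zeroSumCopy simple χ-sym (switching⇒swappable simple switching-v) (switching⇒swappable simple switching-w)
    (Unique-++⇒Disjoint {xs = v₁ ∷ v₂ ∷ v₃ ∷ v₄ ∷ []} vw!) σ σ-inj alternating-c alternating-d
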